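{- Let $x$ and $y$ be two strings that do not contain $\$$. If $\mathrm{ED}(x,y)=r$, then (i) there exists a transformation $T$ of length $r$ that solves $x\$$ and $y\$$, and (ii) there does not exist any transformation $T'$ of length $<r$ that solves $x\$$ and $y\$$.
   Context: $\mathrm{ED}(x,y)$ is the edit distance (minimum number of single-character insertions, deletions, replacements turning $x$ into $y$). $x\$$ denotes $x$ with the symbol $\$$ appended; a string is $\$$-terminal if its last character is $\$$ and $\$$ occurs nowhere else. Strings are 0-indexed. A transformation is a finite sequence over $\{\texttt{insert},\texttt{delete},\texttt{replace}\}$. A transformation $T$ is valid for $\$$-terminal strings $x,y$ if the number of \texttt{delete} plus \texttt{replace} entries is at most $|x|$ and the number of \texttt{insert} plus \texttt{replace} entries is at most $|y|$. For valid $T$, the string $T(x,y)$ is defined inductively: if $T$ is empty, $T(x,y)=x$. Otherwise let $T'$ be $T$ with its last entry $\sigma$ removed, and let $i$ be the smallest index such that the $i$-th character of $T'(x,y)$ differs from $y_i$ if $T'(x,y)\ne y$, and $i=0$ if $T'(x,y)=y$. If $\sigma=\texttt{insert}$, $T(x,y)$ is obtained by inserting $y_i$ at position $i$ of $T'(x,y)$; if $\sigma=\texttt{delete}$, by deleting the $i$-th character of $T'(x,y)$; if $\sigma=\texttt{replace}$, by replacing the $i$-th character of $T'(x,y)$ with $y_i$. $T$ solves $x$ and $y$ if $T$ is valid for $x,y$, $T(x,y)=y$, and for every $j<|T|$ the prefix $T[j]$ of length $j$ satisfies $T[j](x,y)\ne y$. -}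

module Defs where

open import Data.Nat using (ℕ; zero; suc; _+_; _≤_; _<_)
open import Data.List using (List; []; _∷_; _++_; length; foldl; take; _∷ʳ_)
open import Data.List.Properties using (≡-dec)
open import Data.Maybe using (Maybe; just; nothing; _>>=_) renaming (map to mapMaybe)
open import Data.Product using (Σ; ∃; _×_; _,_)
open import Data.Sum using (_⊎_)
open import Relation.Binary.Definitions using (DecidableEquality)
open import Relation.Binary.PropositionalEquality using (_≡_; _≢_)
open import Relation.Nullary using (¬_; yes; no)

data EditStep {A : Set} : List A → List A → Set where
  ins : (p q : List A) (c : A)   → EditStep (p ++ q) (p ++ c ∷ q)
  del : (p q : List A) (c : A)   → EditStep (p ++ c ∷ q) (p ++ q)
  rep : (p q : List A) (a c : A) → EditStep (p ++ a ∷ q) (p ++ c ∷ q)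

data EditSeq {A : Set} : List A → List A → ℕ → Set where
  done : (s : List A) → EditSeq s s 0
  step : {s t u : List A} {k : ℕ} → EditStep s t → EditSeq t u k → EditSeq s u (suc k)

IsED : {A : Set} → List A → List A → ℕ → Set
IsED x y r = EditSeq x y r × (∀ k → k < r → ¬ EditSeq x y k)

data Op : Set where
  insert delete replace : Op

countOp : (Op → ℕ) → List Op → ℕ
countOp w []      = 0
countOp w (o ∷ T) = w o + countOp w T

delRepW : Op → ℕ
delRepW insert  = 0
delRepW delete  = 1
delRepW replace = 1

insRepW : Op → ℕ
insRepW insert  = 1
insRepW delete  = 0
insRepW replace = 1

Valid : {A : Set} → List Op → List A → List A → Set
Valid T x y = countOp delRepW T ≤ length x × countOp insRepW T ≤ length y

at : {A : Set} → ℕ → List A → Maybe A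
at _       []      = nothing
at zero    (a ∷ s) = just a
at (suc i) (a ∷ s) = at i s

insAt : {A : Set} → ℕ → A → List A → Maybe (List A)
insAt zero    c s       = just (c ∷ s)
insAt (suc i) c []      = nothing
insAt (suc i) c (a ∷ s) = mapMaybe (a ∷_) (insAt i c s)

delAt : {A : Set} → ℕ → List A → Maybe (List A)
delAt _       []      = nothing
delAt zero    (a ∷ s) = just s
delAt (suc i) (a ∷ s) = mapMaybe (a ∷_) (delAt i s)

repAt : {A : Set} → ℕ → A → List A → Maybe (List A)
repAt _       c []      = nothing
repAt zero    c (a ∷ s) = just (c ∷ s)
repAt (suc i) c (a ∷ s) = mapMaybe (a ∷_) (repAt i c s)

module _ {A : Set} (_≟_ : DecidableEquality A) where

  -- smallest index where s and y differ (an index present in only one of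
  -- them counts as a difference); only used when s ≢ y
  firstDiff : List A → List A → ℕ
  firstDiff (a ∷ s) (b ∷ t) with a ≟ b
  ... | yes _ = suc (firstDiff s t)
  ... | no  _ = 0
  firstDiff _ _ = 0

  index : List A → List A → ℕ
  index s y with ≡-dec _≟_ s y
  ... | yes _ = 0
  ... | no  _ = firstDiff s y

  applyOp : List A → List A → Op → Maybe (List A)
  applyOp y s insert  = at (index s y) y >>= λ c → insAt (index s y) c s
  applyOp y s delete  = delAt (index s y) s
  applyOp y s replace = at (index s y) y >>= λ c → repAt (index s y) c s

  -- T(x , y); nothing means an operation was undefined
  runT : List Op → List A → List A → Maybe (List A)
  runT T x y = foldl (λ ms σ → ms >>= λ s → applyOp y s σ) (just x) T

  Solves : List Op → List A → List A → Set
  Solves T x y = Valid T x y × runT T x y ≡ just y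
               × (∀ j → j < length T → runT (take j T) x y ≢ just y)

module Submission where

open import Defs
open import Data.Nat using (ℕ; _<_)
open import Data.List using (List; length; _∷ʳ_)
open import Data.List.Membership.Propositional using (_∉_)
open import Data.Product using (∃; _×_)
open import Relation.Binary.Definitions using (DecidableEquality)
open import Relation.Binary.PropositionalEquality using (_≡_)
open import Relation.Nullary using (¬_)

open import Data.Nat using (zero; suc; _+_; _≤_; _⊓_; z≤n; s≤s)
open import Data.Nat.Properties
open import Data.List using ([]; _∷_; _++_; take; foldl)
open import Data.List.Properties using (++-assoc; ++-cancelˡ; ∷-injectiveˡ; ≡-dec; length-++-sucʳ)
open import Data.List.Relation.Unary.Any using (here; there)
open import Data.Maybe using (just; nothing; _>>=_)
open import Data.Maybe.Properties using (just-injective)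
open import Data.Product using (_,_)
open import Data.Sum using (inj₁; inj₂)
open import Data.Empty using (⊥-elim)
open import Relation.Nullary using (yes; no; Dec)
open import Relation.Binary.PropositionalEquality using (refl; sym; trans; cong; subst; subst₂; _≢_)
open import Function using (_∘_)

-- Proof idea: the edit distance is the Wagner–Fischer recursion `lev`.  An
-- edit step changes `lev` by at most one, and a solving transformation is an
-- edit sequence from x$ to y$, so it has length at least lev (x$) (y$) ≥ lev x y.
-- Conversely, an optimal alignment of x and y is realised from left to right:
-- while the common prefix p already agrees with the target, the sentinel $
-- guarantees that the current string still differs from the target and that
-- its first mismatch is at position |p|, which is exactly where the alignment
-- wants the next operation.

module _ {A : Set} where

  length-∷ʳ : (s : List A) (a : A) → length (s ∷ʳ a) ≡ suc (length s)
  length-∷ʳ []      a = refl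
  length-∷ʳ (b ∷ s) a = cong suc (length-∷ʳ s a)

  EditStep-cons : {s t : List A} (a : A) → EditStep s t → EditStep (a ∷ s) (a ∷ t)
  EditStep-cons a (ins p q c)   = ins (a ∷ p) q c
  EditStep-cons a (del p q c)   = del (a ∷ p) q c
  EditStep-cons a (rep p q b c) = rep (a ∷ p) q b c

  EditStep-sym : {s t : List A} → EditStep s t → EditStep t s
  EditStep-sym (ins p q c)   = del p q c
  EditStep-sym (del p q c)   = ins p q c
  EditStep-sym (rep p q b c) = rep p q c b

  EditStep-length : {s t : List A} → EditStep s t → length t ≤ suc (length s)
  EditStep-length (ins p q c)   = ≤-reflexive (length-++-sucʳ p c q)
  EditStep-length (del p q c)   rewrite length-++-sucʳ p c q = m≤n+m _ 2
  EditStep-length (rep p q b c) rewrite length-++-sucʳ p c q | length-++-sucʳ p b q = n≤1+n _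

  EditSeq-cons : {s t : List A} {k : ℕ} (a : A) → EditSeq s t k → EditSeq (a ∷ s) (a ∷ t) k
  EditSeq-cons a (done s)     = done (a ∷ s)
  EditSeq-cons a (step st ss) = step (EditStep-cons a st) (EditSeq-cons a ss)

  EditSeq-snoc : {s t u : List A} {k : ℕ} → EditSeq s t k → EditStep t u → EditSeq s u (suc k)
  EditSeq-snoc (done s)     st′ = step st′ (done _)
  EditSeq-snoc (step st ss) st′ = step st (EditSeq-snoc ss st′)

  EditSeq-sym : {s t : List A} {k : ℕ} → EditSeq s t k → EditSeq t s k
  EditSeq-sym (done s)     = done s
  EditSeq-sym (step st ss) = EditSeq-snoc (EditSeq-sym ss) (EditStep-sym st)

  EditSeq-length : {s t : List A} {k : ℕ} → EditSeq s t k → length t ≤ length s + k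
  EditSeq-length {s} (done s) = m≤m+n (length s) 0
  EditSeq-length {s} {k = suc k} (step st ss) = begin
    _                    ≤⟨ EditSeq-length ss ⟩
    _ + k                ≤⟨ +-monoˡ-≤ k (EditStep-length st) ⟩
    suc (length s) + k   ≡⟨ +-suc (length s) k ⟨
    length s + suc k     ∎
    where open ≤-Reasoning

  insertAll : (u : List A) → EditSeq [] u (length u)
  insertAll []      = done []
  insertAll (b ∷ u) = step (ins [] [] b) (EditSeq-cons b (insertAll u))

min3 : ℕ → ℕ → ℕ → ℕ
min3 x y z = x ⊓ (y ⊓ z)

min3-elim : {Q : ℕ → Set} (x y z : ℕ) → Q x → Q y → Q z → Q (min3 x y z)
min3-elim {Q} x y z qx qy qz with ⊓-sel x (y ⊓ z)
... | inj₁ e = subst Q (sym e) qx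
... | inj₂ e with ⊓-sel y z
...   | inj₁ e′ = subst Q (sym (trans e e′)) qy
...   | inj₂ e′ = subst Q (sym (trans e e′)) qz

min3-glb : ∀ {m x y z} → m ≤ x → m ≤ y → m ≤ z → m ≤ min3 x y z
min3-glb {m} = min3-elim {m ≤_} _ _ _

min3≤₁ : ∀ x y z → min3 x y z ≤ x
min3≤₁ x y z = m⊓n≤m x (y ⊓ z)

min3≤₂ : ∀ x y z → min3 x y z ≤ y
min3≤₂ x y z = ≤-trans (m⊓n≤n x (y ⊓ z)) (m⊓n≤m y z)

min3≤₃ : ∀ x y z → min3 x y z ≤ z
min3≤₃ x y z = ≤-trans (m⊓n≤n x (y ⊓ z)) (m⊓n≤n y z)

min3-mono-≤ : ∀ {x x′ y y′ z z′} → x ≤ x′ → y ≤ y′ → z ≤ z′ → min3 x y z ≤ min3 x′ y′ z′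
min3-mono-≤ p q r = ⊓-mono-≤ p (⊓-mono-≤ q r)

module Levenshtein {A : Set} (_≟_ : DecidableEquality A) where

  mismatch : A → A → ℕ
  mismatch a b with a ≟ b
  ... | yes _ = 0
  ... | no  _ = 1

  mismatch≤1 : ∀ a b → mismatch a b ≤ 1
  mismatch≤1 a b with a ≟ b
  ... | yes _ = z≤n
  ... | no  _ = s≤s z≤n

  mismatch-refl : ∀ a → mismatch a a ≡ 0
  mismatch-refl a with a ≟ a
  ... | yes _  = refl
  ... | no a≢a = ⊥-elim (a≢a refl)

  mismatch-≢ : ∀ {a b} → a ≢ b → mismatch a b ≡ 1
  mismatch-≢ {a} {b} a≢b with a ≟ b
  ... | yes a≡b = ⊥-elim (a≢b a≡b)
  ... | no  _   = refl

  lev : List A → List A → ℕ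
  lev []      u       = length u
  lev (a ∷ s) []      = suc (length s)
  lev (a ∷ s) (b ∷ u) = min3 (mismatch a b + lev s u) (suc (lev s (b ∷ u))) (suc (lev (a ∷ s) u))

  lev-[]ʳ : ∀ s → lev s [] ≡ length s
  lev-[]ʳ []      = refl
  lev-[]ʳ (a ∷ s) = refl

  lev-consˡ-≤ : ∀ c s u → lev (c ∷ s) u ≤ suc (lev s u)
  lev-consˡ-≤ c s []      rewrite lev-[]ʳ s = ≤-refl
  lev-consˡ-≤ c s (b ∷ u) = min3≤₂ (mismatch c b + lev s u) _ _

  lev-consʳ-≤ : ∀ s b u → lev s (b ∷ u) ≤ suc (lev s u)
  lev-consʳ-≤ []      b u = ≤-refl
  lev-consʳ-≤ (a ∷ s) b u = min3≤₃ (mismatch a b + lev s u) _ _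

  lev-≤-consˡ : ∀ c s u → lev s u ≤ suc (lev (c ∷ s) u)
  lev-≤-consˡ c s []      rewrite lev-[]ʳ s = m≤n+m _ 2
  lev-≤-consˡ c s (b ∷ u) = min3-glb
    (≤-trans (lev-consʳ-≤ s b u) (s≤s (m≤n+m _ (mismatch c b))))
    (m≤n+m _ 2)
    (≤-trans (lev-consʳ-≤ s b u) (s≤s (lev-≤-consˡ c s u)))

  lev-≤-consʳ : ∀ s c u → lev s u ≤ suc (lev s (c ∷ u))
  lev-≤-consʳ []      c u = m≤n+m _ 2
  lev-≤-consʳ (a ∷ s) c u = min3-glb
    (≤-trans (lev-consˡ-≤ a s u) (s≤s (m≤n+m _ (mismatch a c))))
    (≤-trans (lev-consˡ-≤ a s u) (s≤s (lev-≤-consʳ s c u)))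
    (m≤n+m _ 2)

  lev-≤-replaceˡ : ∀ a c s u → lev (a ∷ s) u ≤ suc (lev (c ∷ s) u)
  lev-≤-replaceˡ a c s []      = n≤1+n _
  lev-≤-replaceˡ a c s (b ∷ u) = min3-glb
    (≤-trans (min3≤₁ (mismatch a b + lev s u) _ _)
             (+-monoˡ-≤ (lev s u) (≤-trans (mismatch≤1 a b) (s≤s z≤n))))
    (≤-trans (min3≤₂ (mismatch a b + lev s u) _ _) (n≤1+n _))
    (≤-trans (min3≤₃ (mismatch a b + lev s u) _ _) (s≤s (lev-≤-replaceˡ a c s u)))

  lev-≤-prefix : ∀ p {s t} → (∀ u → lev s u ≤ suc (lev t u)) → ∀ u → lev (p ++ s) u ≤ suc (lev (p ++ t) u)
  lev-≤-prefix []          h u       = h u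
  lev-≤-prefix (a ∷ p) {s} {t} h [] =
    s≤s (subst₂ (λ m n → m ≤ suc n) (lev-[]ʳ (p ++ s)) (lev-[]ʳ (p ++ t)) (lev-≤-prefix p h []))
  lev-≤-prefix (a ∷ p) {s} {t} h (b ∷ u) = min3-mono-≤
    (≤-trans (+-monoʳ-≤ (mismatch a b) (lev-≤-prefix p h u)) (≤-reflexive (+-suc _ _)))
    (s≤s (lev-≤-prefix p h (b ∷ u)))
    (s≤s (lev-≤-prefix (a ∷ p) h u))

  lev-EditStep : ∀ {s t} → EditStep s t → ∀ u → lev s u ≤ suc (lev t u)
  lev-EditStep (ins p q c)   = lev-≤-prefix p (lev-≤-consˡ c q)
  lev-EditStep (del p q c)   = lev-≤-prefix p (lev-consˡ-≤ c q)
  lev-EditStep (rep p q b c) = lev-≤-prefix p (lev-≤-replaceˡ b c q)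

  lev-refl : ∀ s → lev s s ≡ 0
  lev-refl []      = refl
  lev-refl (a ∷ s) = n≤0⇒n≡0 (≤-trans (min3≤₁ (mismatch a a + lev s s) _ _)
    (≤-reflexive (trans (cong (_+ lev s s) (mismatch-refl a)) (lev-refl s))))

  lev-≤-EditSeq : ∀ {s u k} → EditSeq s u k → lev s u ≤ k
  lev-≤-EditSeq (done s)             = ≤-reflexive (lev-refl s)
  lev-≤-EditSeq {u = u} (step st ss) = ≤-trans (lev-EditStep st u) (s≤s (lev-≤-EditSeq ss))

  EditSeq-heads : ∀ {s u k} a b → EditSeq s u k → EditSeq (a ∷ s) (b ∷ u) (mismatch a b + k)
  EditSeq-heads a b ss with a ≟ b
  ... | yes refl = EditSeq-cons a ss
  ... | no  _    = step (rep [] _ a b) (EditSeq-cons b ss)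

  EditSeq-lev : ∀ s u → EditSeq s u (lev s u)
  EditSeq-lev []      u       = insertAll u
  EditSeq-lev (a ∷ s) []      = EditSeq-sym (insertAll (a ∷ s))
  EditSeq-lev (a ∷ s) (b ∷ u) = min3-elim {EditSeq (a ∷ s) (b ∷ u)} _ _ _
    (EditSeq-heads a b (EditSeq-lev s u))
    (step (del [] s a) (EditSeq-lev s (b ∷ u)))
    (EditSeq-snoc (EditSeq-lev (a ∷ s) u) (ins [] u b))

  IsED⇒≡lev : ∀ {x y r} → IsED x y r → r ≡ lev x y
  IsED⇒≡lev {x} {y} (ss , minimal) =
    ≤-antisym (≮⇒≥ (λ lev<r → minimal (lev x y) lev<r (EditSeq-lev x y))) (lev-≤-EditSeq ss)

  lev-cons-cons : ∀ a s u → lev (a ∷ s) (a ∷ u) ≡ lev s u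
  lev-cons-cons a s u = ≤-antisym
    (≤-trans (min3≤₁ (mismatch a a + lev s u) _ _) (≤-reflexive (cong (_+ lev s u) (mismatch-refl a))))
    (min3-glb (m≤n+m _ (mismatch a a)) (lev-≤-consʳ s a u) (lev-≤-consˡ a s u))

  lev-∷ʳ-mono : ∀ x y a b → lev x y ≤ lev (x ∷ʳ a) (y ∷ʳ b)
  lev-∷ʳ-mono []      y       a b = ≤-pred (begin
    suc (length y)                         ≡⟨ length-∷ʳ y b ⟨
    length (y ∷ʳ b)                        ≤⟨ EditSeq-length (EditSeq-lev (a ∷ []) (y ∷ʳ b)) ⟩
    suc (lev (a ∷ []) (y ∷ʳ b))            ∎)
    where open ≤-Reasoning
  lev-∷ʳ-mono (c ∷ x) []      a b = ≤-pred (begin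
    suc (suc (length x))                   ≡⟨ cong suc (length-∷ʳ x a) ⟨
    length ((c ∷ x) ∷ʳ a)                  ≤⟨ EditSeq-length (EditSeq-sym (EditSeq-lev ((c ∷ x) ∷ʳ a) (b ∷ []))) ⟩
    suc (lev ((c ∷ x) ∷ʳ a) (b ∷ []))      ∎)
    where open ≤-Reasoning
  lev-∷ʳ-mono (c ∷ x) (d ∷ y) a b = min3-mono-≤
    (+-monoʳ-≤ (mismatch c d) (lev-∷ʳ-mono x y a b))
    (s≤s (lev-∷ʳ-mono x (d ∷ y) a b))
    (s≤s (lev-∷ʳ-mono (c ∷ x) y a b))

module Transformations {A : Set} (_≟_ : DecidableEquality A) where

  foldl-nothing : ∀ y T → foldl (λ ms σ → ms >>= λ s → applyOp _≟_ y s σ) nothing T ≡ nothing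
  foldl-nothing y []      = refl
  foldl-nothing y (o ∷ T) = foldl-nothing y T

  insAt-EditStep : ∀ i (c : A) s {s′} → insAt i c s ≡ just s′ → EditStep s s′
  insAt-EditStep zero    c s       refl = ins [] s c
  insAt-EditStep (suc i) c []      ()
  insAt-EditStep (suc i) c (a ∷ s) eq with insAt i c s in e
  insAt-EditStep (suc i) c (a ∷ s) refl | just _ = EditStep-cons a (insAt-EditStep i c s e)
  insAt-EditStep (suc i) c (a ∷ s) ()   | nothing

  delAt-EditStep : ∀ i (s : List A) {s′} → delAt i s ≡ just s′ → EditStep s s′
  delAt-EditStep i       []      ()
  delAt-EditStep zero    (a ∷ s) refl = del [] s a
  delAt-EditStep (suc i) (a ∷ s) eq with delAt i s in e
  delAt-EditStep (suc i) (a ∷ s) refl | just _ = EditStep-cons a (delAt-EditStep i s e)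
  delAt-EditStep (suc i) (a ∷ s) ()   | nothing

  repAt-EditStep : ∀ i (c : A) s {s′} → repAt i c s ≡ just s′ → EditStep s s′
  repAt-EditStep i       c []      ()
  repAt-EditStep zero    c (a ∷ s) refl = rep [] s a c
  repAt-EditStep (suc i) c (a ∷ s) eq with repAt i c s in e
  repAt-EditStep (suc i) c (a ∷ s) refl | just _ = EditStep-cons a (repAt-EditStep i c s e)
  repAt-EditStep (suc i) c (a ∷ s) ()   | nothing

  applyOp-EditStep : ∀ y s o {s′} → applyOp _≟_ y s o ≡ just s′ → EditStep s s′
  applyOp-EditStep y s insert  eq with at (index _≟_ s y) y
  ... | just c = insAt-EditStep (index _≟_ s y) c s eq
  applyOp-EditStep y s delete  eq = delAt-EditStep (index _≟_ s y) s eq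
  applyOp-EditStep y s replace eq with at (index _≟_ s y) y
  ... | just c = repAt-EditStep (index _≟_ s y) c s eq

  runT-EditSeq : ∀ T {s y t} → runT _≟_ T s y ≡ just t → EditSeq s t (length T)
  runT-EditSeq []      refl = done _
  runT-EditSeq (o ∷ T) {s} {y} eq with applyOp _≟_ y s o in e
  ... | just _  = step (applyOp-EditStep y s o e) (runT-EditSeq T eq)
  ... | nothing with trans (sym (foldl-nothing y T)) eq
  ...   | ()

  ReachesFirst : List Op → List A → List A → Set
  ReachesFirst T s y = runT _≟_ T s y ≡ just y × (∀ j → j < length T → runT _≟_ (take j T) s y ≢ just y)

  reachesFirst-∷ : ∀ {T s s′ y} o → s ≢ y → applyOp _≟_ y s o ≡ just s′ → ReachesFirst T s′ y
                 → ReachesFirst (o ∷ T) s y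
  reachesFirst-∷ {T} {s} {s′} {y} o s≢y e (reaches , first) = reaches′ , first′
    where
      reaches′ : runT _≟_ (o ∷ T) s y ≡ just y
      reaches′ rewrite e = reaches
      first′ : ∀ j → j < suc (length T) → runT _≟_ (take j (o ∷ T)) s y ≢ just y
      first′ zero    _         eq = s≢y (just-injective eq)
      first′ (suc j) (s≤s j<n) eq rewrite e = first j j<n eq

  ++-∷-≢ : ∀ p {a b : A} r t → a ≢ b → p ++ a ∷ r ≢ p ++ b ∷ t
  ++-∷-≢ p r t a≢b eq = a≢b (∷-injectiveˡ (++-cancelˡ p _ _ eq))

  firstDiff-mismatch : ∀ p {a b : A} r t → a ≢ b → firstDiff _≟_ (p ++ a ∷ r) (p ++ b ∷ t) ≡ length p
  firstDiff-mismatch [] {a} {b} r t a≢b with a ≟ b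
  ... | yes a≡b = ⊥-elim (a≢b a≡b)
  ... | no  _   = refl
  firstDiff-mismatch (c ∷ p) r t a≢b with c ≟ c
  ... | yes _   = cong suc (firstDiff-mismatch p r t a≢b)
  ... | no  c≢c = ⊥-elim (c≢c refl)

  index-mismatch : ∀ p {a b : A} r t → a ≢ b → index _≟_ (p ++ a ∷ r) (p ++ b ∷ t) ≡ length p
  index-mismatch p {a} {b} r t a≢b with ≡-dec _≟_ (p ++ a ∷ r) (p ++ b ∷ t)
  ... | yes eq = ⊥-elim (++-∷-≢ p r t a≢b eq)
  ... | no  _  = firstDiff-mismatch p r t a≢b

  at-length : ∀ p (b : A) t → at (length p) (p ++ b ∷ t) ≡ just b
  at-length []      b t = refl
  at-length (c ∷ p) b t = at-length p b t

  insAt-length : ∀ p (c : A) r → insAt (length p) c (p ++ r) ≡ just (p ++ c ∷ r)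
  insAt-length []      c r = refl
  insAt-length (d ∷ p) c r rewrite insAt-length p c r = refl

  delAt-length : ∀ p (a : A) r → delAt (length p) (p ++ a ∷ r) ≡ just (p ++ r)
  delAt-length []      a r = refl
  delAt-length (d ∷ p) a r rewrite delAt-length p a r = refl

  repAt-length : ∀ p (a c : A) r → repAt (length p) c (p ++ a ∷ r) ≡ just (p ++ c ∷ r)
  repAt-length []      a c r = refl
  repAt-length (d ∷ p) a c r rewrite repAt-length p a c r = refl

  applyOp-insert : ∀ p {a b : A} r t → a ≢ b →
                   applyOp _≟_ (p ++ b ∷ t) (p ++ a ∷ r) insert ≡ just (p ++ b ∷ a ∷ r)
  applyOp-insert p {a} {b} r t a≢b
    rewrite index-mismatch p r t a≢b | at-length p b t = insAt-length p b (a ∷ r)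

  applyOp-delete : ∀ p {a b : A} r t → a ≢ b →
                   applyOp _≟_ (p ++ b ∷ t) (p ++ a ∷ r) delete ≡ just (p ++ r)
  applyOp-delete p {a} r t a≢b rewrite index-mismatch p r t a≢b = delAt-length p a r

  applyOp-replace : ∀ p {a b : A} r t → a ≢ b →
                    applyOp _≟_ (p ++ b ∷ t) (p ++ a ∷ r) replace ≡ just (p ++ b ∷ r)
  applyOp-replace p {a} {b} r t a≢b
    rewrite index-mismatch p r t a≢b | at-length p b t = repAt-length p a b r

  reachesFirst-shift : ∀ {T} p (b : A) r t → ReachesFirst T ((p ∷ʳ b) ++ r) ((p ∷ʳ b) ++ t)
                     → ReachesFirst T (p ++ b ∷ r) (p ++ b ∷ t)
  reachesFirst-shift {T} p b r t = subst₂ (ReachesFirst T) (++-assoc p (b ∷ []) r) (++-assoc p (b ∷ []) t)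

  Solution : List A → List A → List A → ℕ → Set
  Solution p r t n = ∃ λ T → length T ≡ n × Valid T r t × ReachesFirst T (p ++ r) (p ++ t)

  solution-match : ∀ {p} a {r t n} → Solution (p ∷ʳ a) r t n → Solution p (a ∷ r) (a ∷ t) n
  solution-match {p} a {r} {t} (T , len , (dels , inss) , reaches) =
    T , len , (m≤n⇒m≤1+n dels , m≤n⇒m≤1+n inss) , reachesFirst-shift p a r t reaches

  solution-insert : ∀ {p a b r t n} → a ≢ b → Solution (p ∷ʳ b) (a ∷ r) t n → Solution p (a ∷ r) (b ∷ t) (suc n)
  solution-insert {p} {a} {b} {r} {t} a≢b (T , len , (dels , inss) , reaches) =
    insert ∷ T , cong suc len , (dels , s≤s inss) ,
    reachesFirst-∷ insert (++-∷-≢ p r t a≢b) (applyOp-insert p r t a≢b) (reachesFirst-shift p b (a ∷ r) t reaches)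

  solution-delete : ∀ {p a b r t n} → a ≢ b → Solution p r (b ∷ t) n → Solution p (a ∷ r) (b ∷ t) (suc n)
  solution-delete {p} {r = r} {t} a≢b (T , len , (dels , inss) , reaches) =
    delete ∷ T , cong suc len , (s≤s dels , inss) ,
    reachesFirst-∷ delete (++-∷-≢ p r t a≢b) (applyOp-delete p r t a≢b) reaches

  solution-replace : ∀ {p a b r t n} → a ≢ b → Solution (p ∷ʳ b) r t n → Solution p (a ∷ r) (b ∷ t) (suc n)
  solution-replace {p} {b = b} {r} {t} a≢b (T , len , (dels , inss) , reaches) =
    replace ∷ T , cong suc len , (s≤s dels , s≤s inss) ,
    reachesFirst-∷ replace (++-∷-≢ p r t a≢b) (applyOp-replace p r t a≢b) (reachesFirst-shift p b r t reaches)

module Construction {A : Set} (_≟_ : DecidableEquality A) ($ : A) where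
  open Levenshtein _≟_
  open Transformations _≟_

  solution-cons : ∀ p a s b u → Dec (a ≡ b)
    → Solution (p ∷ʳ b) (s ∷ʳ $) (u ∷ʳ $) (lev s u)
    → Solution p (s ∷ʳ $) ((b ∷ u) ∷ʳ $) (lev s (b ∷ u))
    → Solution (p ∷ʳ b) ((a ∷ s) ∷ʳ $) (u ∷ʳ $) (lev (a ∷ s) u)
    → Solution p ((a ∷ s) ∷ʳ $) ((b ∷ u) ∷ʳ $) (lev (a ∷ s) (b ∷ u))
  solution-cons p a s b u (yes refl) S _ _ =
    subst (Solution p _ _) (sym (lev-cons-cons a s u)) (solution-match a S)
  solution-cons p a s b u (no a≢b) S₁ S₂ S₃ = min3-elim {Solution p _ _} _ _ _
    (subst (Solution p _ _) (cong (_+ lev s u) (sym (mismatch-≢ a≢b))) (solution-replace a≢b S₁))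
    (solution-delete a≢b S₂)
    (solution-insert a≢b S₃)

  solution : ∀ p s u → $ ∉ s → $ ∉ u → Solution p (s ∷ʳ $) (u ∷ʳ $) (lev s u)
  solution p []      []      _   _   = [] , refl , (z≤n , z≤n) , refl , λ _ ()
  solution p []      (b ∷ u) s∌$ u∌$ =
    solution-insert (u∌$ ∘ here) (solution (p ∷ʳ b) [] u s∌$ (u∌$ ∘ there))
  solution p (a ∷ s) []      s∌$ u∌$ =
    subst (Solution p _ _) (cong suc (lev-[]ʳ s))
      (solution-delete (s∌$ ∘ here ∘ sym) (solution p s [] (s∌$ ∘ there) u∌$))
  solution p (a ∷ s) (b ∷ u) s∌$ u∌$ = solution-cons p a s b u (a ≟ b)
    (solution (p ∷ʳ b) s u (s∌$ ∘ there) (u∌$ ∘ there))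
    (solution p s (b ∷ u) (s∌$ ∘ there) u∌$)
    (solution (p ∷ʳ b) (a ∷ s) u s∌$ (u∌$ ∘ there))

lemma4p6 : {A : Set} (_≟_ : DecidableEquality A) ($ : A) (x y : List A) (r : ℕ) →
    $ ∉ x → $ ∉ y → IsED x y r →
    (∃ λ T → length T ≡ r × Solves _≟_ T (x ∷ʳ $) (y ∷ʳ $))
    × (∀ T′ → length T′ < r → ¬ Solves _≟_ T′ (x ∷ʳ $) (y ∷ʳ $))
lemma4p6 _≟_ $ x y r x∌$ y∌$ isED = existence , minimality
  where
    open Levenshtein _≟_
    open Transformations _≟_
    open Construction _≟_ $

    r≡lev : r ≡ lev x y
    r≡lev = IsED⇒≡lev isED

    existence : ∃ λ T → length T ≡ r × Solves _≟_ T (x ∷ʳ $) (y ∷ʳ $)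
    existence with solution [] x y x∌$ y∌$
    ... | T , len , solves = T , trans len (sym r≡lev) , solves

    minimality : ∀ T′ → length T′ < r → ¬ Solves _≟_ T′ (x ∷ʳ $) (y ∷ʳ $)
    minimality T′ T′<r (_ , reaches , _) = <⇒≱ T′<r (begin
      r                         ≡⟨ r≡lev ⟩
      lev x y                   ≤⟨ lev-∷ʳ-mono x y $ $ ⟩
      lev (x ∷ʳ $) (y ∷ʳ $)     ≤⟨ lev-≤-EditSeq (runT-EditSeq T′ reaches) ⟩
      length T′                 ∎)
      where open ≤-Reasoning
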